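{- Let $G$ be an ordered graph on $[n]$ and let $r \in \mathbb{N}$. Then $$\big|\{H \in \partial G : m(H) \leqslant m(G) + 2r + 1\}\big| \;\geqslant\; \frac{1}{2}\Big(1 - \frac{1}{r}\Big)n - \frac{m(G)}{2}.$$
   Context: An ordered graph is a graph with a linear order on its vertices, identified with one on $[n]$ with the usual order. $G - v$ is the induced ordered subgraph on $V(G)\setminus\{v\}$; $\partial G = \{G - v : v \in V(G)\}$. For $x,y \in V(G)$ write $x \sim y$ if $\Gamma(x)\setminus\{y\} = \Gamma(y)\setminus\{x\}$. A homogeneous block is a maximal set of consecutive vertices any two of which satisfy $x\sim y$. The excess of $G$ is $m(G) = \sum_{B \text{ homogeneous block}, |B|\geqslant 3}(|B|-2)$. -}

module Defs where

open import Data.Bool using (Bool; true; false; _∧_; _∨_; not; _xor_)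
import Data.Bool.Properties as BoolP
open import Data.Nat using (ℕ; zero; suc; _+_; _*_; _∸_; _≤ᵇ_; _<ᵇ_; _≡ᵇ_)
open import Data.Fin using (Fin)
open import Data.Vec using (Vec; []; _∷_; lookup; replicate; removeAt)
import Data.Vec as Vec
open import Data.Vec.Properties using (≡-dec)
open import Data.List using (List; map; upTo; concatMap; filterᵇ; length; deduplicate; allFin)
open import Data.Bool.ListAction using (all)
open import Data.Nat.ListAction using (sum)
open import Relation.Binary.PropositionalEquality using (_≡_)
open import Relation.Nullary using (Dec)

-- An ordered graph on [n] = {0,…,n-1} (usual order), given by its
-- adjacency matrix.  Symmetry and irreflexivity are hypotheses.
Adj : ℕ → Set
Adj n = Vec (Vec Bool n) n

Symmetric : ∀ {n} → Adj n → Set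
Symmetric {n} G = (i j : Fin n) → lookup (lookup G i) j ≡ lookup (lookup G j) i

Irreflexive : ∀ {n} → Adj n → Set
Irreflexive {n} G = (i : Fin n) → lookup (lookup G i) i ≡ false

lookupℕ : ∀ {A : Set} {n} → A → Vec A n → ℕ → A
lookupℕ d []       _       = d
lookupℕ d (x ∷ xs) zero    = x
lookupℕ d (x ∷ xs) (suc i) = lookupℕ d xs i

edge : ∀ {n} → Adj n → ℕ → ℕ → Bool
edge {n} G i j = lookupℕ false (lookupℕ (replicate n false) G i) j

-- x ∼ y  iff  Γ(x) \ {y} = Γ(y) \ {x}, i.e. for every vertex z ∉ {x,y},
-- z is adjacent to x iff z is adjacent to y (x ∉ Γ(x), y ∉ Γ(y) by irreflexivity)
twin : ∀ {n} → Adj n → ℕ → ℕ → Bool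
twin {n} G x y =
  all (λ z → (z ≡ᵇ x) ∨ (z ≡ᵇ y) ∨ not (edge G x z xor edge G y z)) (upTo n)

interval : ℕ → ℕ → List ℕ
interval a b = map (a +_) (upTo (suc (b ∸ a)))

pairwiseTwin : ∀ {n} → Adj n → ℕ → ℕ → Bool
pairwiseTwin G a b =
  all (λ i → all (λ j → twin G i j) (interval a b)) (interval a b)

-- {a,…,b} (a ≤ b < n) is a homogeneous block: pairwise ∼ and maximal among
-- sets of consecutive vertices (cannot be extended on the left or right)
isBlock : ∀ {n} → Adj n → ℕ → ℕ → Bool
isBlock {n} G a b =
  (a ≤ᵇ b) ∧ (b <ᵇ n) ∧ pairwiseTwin G a b
  ∧ ((a ≡ᵇ 0) ∨ not (pairwiseTwin G (a ∸ 1) b))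
  ∧ ((suc b ≡ᵇ n) ∨ not (pairwiseTwin G a (suc b)))

open import Data.Product using (_×_; _,_; proj₁; proj₂)

blocks : ∀ {n} → Adj n → List (ℕ × ℕ)
blocks {n} G =
  filterᵇ (λ p → isBlock G (proj₁ p) (proj₂ p))
          (concatMap (λ a → map (λ b → (a , b)) (upTo n)) (upTo n))

-- excess m(G) = Σ_{B block, |B| ≥ 3} (|B| - 2),  with |{a,…,b}| = b - a + 1
excess : ∀ {n} → Adj n → ℕ
excess G =
  sum (map (λ p → suc (proj₂ p ∸ proj₁ p) ∸ 2)
           (filterᵇ (λ p → 3 ≤ᵇ suc (proj₂ p ∸ proj₁ p)) (blocks G)))

-- G - v : induced ordered subgraph on V(G) \ {v}, relabelled onto [n-1]
delete : ∀ {n} → Adj (suc n) → Fin (suc n) → Adj n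
delete G v = Vec.map (λ row → removeAt row v) (removeAt G v)

adjDec : ∀ {n} (G H : Adj n) → Dec (G ≡ H)
adjDec = ≡-dec (≡-dec BoolP._≟_)

-- ∂G = {G - v : v ∈ V(G)}, as a duplicate-free list of ordered graphs on [n-1]
boundary : ∀ {n} → Adj (suc n) → List (Adj n)
boundary {n} G = deduplicate adjDec (map (delete G) (allFin (suc n)))

-- |{H ∈ ∂G : m(H) ≤ m(G) + 2r + 1}|   (∂G = ∅ when n = 0)
goodCount : ∀ {n} → ℕ → Adj n → ℕ
goodCount {zero}  r G = 0
goodCount {suc n} r G =
  length (filterᵇ (λ H → excess H ≤ᵇ excess G + 2 * r + 1) (boundary G))

-- Call k a middle position of G when k ∼ k+1 ∼ k+2.  Homogeneous blocks are the
-- maximal runs of consecutive twins, and a block B contains exactly |B| - 2 middle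
-- positions, so m(G) is the number of middle positions (module Blocks).  Call the
-- pair j, j+1 critical for v when v is the only vertex distinguishing j from j+1;
-- a pair is critical for at most one vertex.  Deleting v creates middle positions
-- only at pairs critical for v or right next to v, so m(G - v) ≤ m(G) + 2c(v) + 2,
-- c(v) being the number of pairs critical for v (module Deletion).  If
-- G - u = G - w = G - x with u < w < x then w - 1 ∼ w ∼ w + 1, i.e. w is the
-- centre of a middle position (module Collisions).  So every vertex is bad
-- (c(v) ≥ r; at most n/r of them), a centre (at most m(G) of them) or eligible;
-- eligible deletions are good and every good graph arises from at most two
-- eligible vertices, whence n ≤ 2·#good + n/r + m(G) (module Deck).
module Submission where

open import Data.Bool using (Bool; true; false; _∧_; _∨_; not; _xor_; if_then_else_; T)
open import Data.Bool.ListAction using (all)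
open import Data.Bool.Properties using (T?)
open import Data.Empty using (⊥; ⊥-elim)
open import Data.Fin using (Fin; zero; suc; toℕ; fromℕ<)
open import Data.Fin.Properties using (toℕ<n)
open import Data.List using (List; []; _∷_; map; applyUpTo; upTo; concatMap; filterᵇ; length; allFin)
open import Data.List.Membership.Propositional using (_∈_)
open import Data.List.Membership.Propositional.Properties using (∈-filter⁺; ∈-map⁺; ∈-allFin; ∈-deduplicate⁺)
open import Data.List.Properties using (map-upTo; map-++; map-∘; map-cong)
open import Data.List.Relation.Unary.All.Properties using (all⁺; all⁻; applyUpTo⁺₁; applyUpTo⁻)
open import Data.List.Relation.Unary.AllPairs using (_∷_)
open import Data.List.Relation.Unary.Any using (here; there)
open import Data.List.Relation.Unary.Unique.Propositional using (Unique)
import Data.List.Relation.Unary.Unique.DecPropositional.Properties as Unique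
open import Data.Nat
open import Data.Nat.ListAction using (sum)
open import Data.Nat.ListAction.Properties using (sum-++)
open import Data.Nat.Properties
open import Data.Nat.Tactic.RingSolver using (solve-∀)
open import Data.Product using (_×_; _,_; proj₁; proj₂; ∃)
import Data.Product
open import Data.Sum using (_⊎_; inj₁; inj₂)
import Data.Sum
open import Data.Vec using (Vec; _∷_; lookup; replicate; removeAt)
import Data.Vec as Vec
open import Function using (_∘_; id)
open import Relation.Binary.Definitions using (tri<; tri≈; tri>; DecidableEquality)
open import Relation.Binary.PropositionalEquality
open import Relation.Nullary using (¬_; Dec; yes; no; does)

open import Defs

bit : Bool → ℕ
bit true = 1
bit false = 0

bit-true : ∀ {b} → T b → bit b ≡ 1
bit-true {true} _ = refl

bit-false : ∀ {b} → ¬ T b → bit b ≡ 0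
bit-false {true} h = ⊥-elim (h _)
bit-false {false} h = refl

∧-intro : ∀ {x y} → T x → T y → T (x ∧ y)
∧-intro {true} _ ty = ty

∧-fst : ∀ x {y} → T (x ∧ y) → T x
∧-fst true _ = _

∧-snd : ∀ x {y} → T (x ∧ y) → T y
∧-snd true t = t

∨-elim : ∀ x {y} → T (x ∨ y) → T x ⊎ T y
∨-elim true _ = inj₁ _
∨-elim false t = inj₂ t

∨-introˡ : ∀ {x} y → T x → T (x ∨ y)
∨-introˡ {true} y _ = _

∨-introʳ : ∀ x {y} → T y → T (x ∨ y)
∨-introʳ true _ = _
∨-introʳ false t = t

not-intro : ∀ x → ¬ T x → T (not x)
not-intro true h = h _
not-intro false _ = _

not-elim : ∀ x → T (not x) → ¬ T x
not-elim true () _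
not-elim false _ ()

does-true : ∀ {P : Set} (d : Dec P) → T (does d) → P
does-true (yes p) _ = p

bit-mono : ∀ x y → (T x → T y) → bit x ≤ bit y
bit-mono true y x⇒y = ≤-reflexive (sym (bit-true (x⇒y _)))
bit-mono false y _ = z≤n

bit-∨ : ∀ x y → bit (x ∨ y) ≤ bit x + bit y
bit-∨ true y = s≤s z≤n
bit-∨ false y = ≤-refl

sumTo : (ℕ → ℕ) → ℕ → ℕ
sumTo f zero = 0
sumTo f (suc K) = sumTo f K + f K

count : (ℕ → Bool) → ℕ → ℕ
count p = sumTo (bit ∘ p)

sumTo-cong : ∀ {f g} K → (∀ k → k < K → f k ≡ g k) → sumTo f K ≡ sumTo g K
sumTo-cong zero h = refl
sumTo-cong (suc K) h = cong₂ _+_ (sumTo-cong K (λ k k<K → h k (m<n⇒m<1+n k<K))) (h K ≤-refl)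

sumTo-mono : ∀ {f g} K → (∀ k → k < K → f k ≤ g k) → sumTo f K ≤ sumTo g K
sumTo-mono zero h = z≤n
sumTo-mono (suc K) h = +-mono-≤ (sumTo-mono K (λ k k<K → h k (m<n⇒m<1+n k<K))) (h K ≤-refl)

sumTo-zero : ∀ {f} K → (∀ k → k < K → f k ≡ 0) → sumTo f K ≡ 0
sumTo-zero zero h = refl
sumTo-zero (suc K) h =
  cong₂ _+_ (sumTo-zero K (λ k k<K → h k (m<n⇒m<1+n k<K))) (h K ≤-refl)

sumTo-+ : ∀ f g K → sumTo (λ k → f k + g k) K ≡ sumTo f K + sumTo g K
sumTo-+ f g zero = refl
sumTo-+ f g (suc K) rewrite sumTo-+ f g K = interchange (sumTo f K) (sumTo g K) (f K) (g K)
  where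
  interchange : ∀ a b c d → (a + b) + (c + d) ≡ (a + c) + (b + d)
  interchange = solve-∀

sumTo-scale : ∀ r f K → r * sumTo f K ≡ sumTo (λ k → r * f k) K
sumTo-scale r f zero = *-zeroʳ r
sumTo-scale r f (suc K) =
  trans (*-distribˡ-+ r (sumTo f K) (f K)) (cong (_+ r * f K) (sumTo-scale r f K))

sumTo-shift : ∀ f K → sumTo f (suc K) ≡ f 0 + sumTo (f ∘ suc) K
sumTo-shift f zero = +-comm 0 (f 0)
sumTo-shift f (suc K) rewrite sumTo-shift f K = +-assoc (f 0) (sumTo (f ∘ suc) K) (f (suc K))

sumTo-split : ∀ f A B → sumTo f (A + B) ≡ sumTo f A + sumTo (λ k → f (A + k)) B
sumTo-split f A zero = trans (cong (sumTo f) (+-identityʳ A)) (sym (+-identityʳ _))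
sumTo-split f A (suc B) =
  trans (cong (sumTo f) (+-suc A B))
        (trans (cong (_+ f (A + B)) (sumTo-split f A B)) (+-assoc (sumTo f A) _ _))

sumTo-swap : ∀ (f : ℕ → ℕ → ℕ) A B →
             sumTo (λ a → sumTo (f a) B) A ≡ sumTo (λ b → sumTo (λ a → f a b) A) B
sumTo-swap f zero B = sym (sumTo-zero B (λ _ _ → refl))
sumTo-swap f (suc A) B rewrite sumTo-swap f A B = sym (sumTo-+ (λ b → sumTo (λ a → f a b) A) (f A) B)

sumTo-extend : ∀ f {J J'} → J ≤ J' → sumTo f J ≤ sumTo f J'
sumTo-extend f {J} J≤J' with m≤n⇒∃[o]m+o≡n J≤J'
... | o , refl = ≤-trans (m≤m+n (sumTo f J) _) (≤-reflexive (sym (sumTo-split f J o)))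

sumTo-reindex : ∀ f g → (∀ k → g k < g (suc k)) → ∀ K J → (∀ k → k < K → g k < J) →
                sumTo (f ∘ g) K ≤ sumTo f J
sumTo-reindex f g increasing zero J bound = z≤n
sumTo-reindex f g increasing (suc K) J bound =
  ≤-trans (+-monoˡ-≤ (f (g K)) (sumTo-reindex f g increasing K (g K) (λ k k<K → below k K k<K)))
          (sumTo-extend f (bound K ≤-refl))
  where
  below : ∀ k K → k < K → g k < g K
  below k (suc K) k<1+K with m≤n⇒m<n∨m≡n (≤-pred k<1+K)
  ... | inj₁ k<K = <-trans (below k K k<K) (increasing K)
  ... | inj₂ refl = increasing k

count-all : ∀ p K → (∀ k → k < K → T (p k)) → count p K ≡ K
count-all p zero h = refl
count-all p (suc K) h =
  trans (cong₂ _+_ (count-all p K (λ k k<K → h k (m<n⇒m<1+n k<K))) (bit-true (h K ≤-refl)))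
        (+-comm K 1)

count-interval : ∀ p a E N → a + E ≤ N →
                 (∀ k → T (p k) → a ≤ k × k < a + E) → (∀ k → a ≤ k → k < a + E → T (p k)) →
                 count p N ≡ E
count-interval p a E N a+E≤N inside onto with m≤n⇒∃[o]m+o≡n a+E≤N
... | r , refl = begin
  count p (a + E + r)                                                 ≡⟨ sumTo-split (bit ∘ p) (a + E) r ⟩
  count p (a + E) + sumTo (λ k → bit (p (a + E + k))) r               ≡⟨ cong₂ _+_ (sumTo-split (bit ∘ p) a E) after ⟩
  count p a + sumTo (λ k → bit (p (a + k))) E + 0                     ≡⟨ cong (λ x → x + sumTo (λ k → bit (p (a + k))) E + 0) before ⟩
  sumTo (λ k → bit (p (a + k))) E + 0                                 ≡⟨ +-identityʳ _ ⟩
  sumTo (λ k → bit (p (a + k))) E                                     ≡⟨ count-all (p ∘ (a +_)) E (λ k k<E → onto (a + k) (m≤m+n a k) (+-monoʳ-< a k<E)) ⟩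
  E ∎
  where
  open ≡-Reasoning
  before : count p a ≡ 0
  before = sumTo-zero a (λ k k<a → bit-false (λ t → <⇒≱ k<a (proj₁ (inside k t))))
  after : sumTo (λ k → bit (p (a + E + k))) r ≡ 0
  after = sumTo-zero r (λ k _ → bit-false (λ t → <⇒≱ (proj₂ (inside _ t)) (m≤m+n (a + E) k)))

count-atMostOne : ∀ p K → (∀ k l → k < K → l < K → T (p k) → T (p l) → k ≡ l) → count p K ≤ 1
count-atMostOne p zero h = z≤n
count-atMostOne p (suc K) h with T? (p K)
... | no ¬pK = ≤-trans (≤-reflexive (trans (cong (count p K +_) (bit-false ¬pK)) (+-identityʳ _)))
                       (count-atMostOne p K (λ k l k<K l<K → h k l (m<n⇒m<1+n k<K) (m<n⇒m<1+n l<K)))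
... | yes pK = ≤-reflexive (cong₂ _+_ (sumTo-zero K none) (bit-true pK))
  where
  none : ∀ k → k < K → bit (p k) ≡ 0
  none k k<K = bit-false (λ pk → <-irrefl (h k K (m<n⇒m<1+n k<K) ≤-refl pk pK) k<K)

count-unique : ∀ p K c → c < K → T (p c) → (∀ k → k < K → T (p k) → k ≡ c) → count p K ≡ 1
count-unique p K c c<K pc only =
  ≤-antisym (count-atMostOne p K (λ k l k<K l<K pk pl → trans (only k k<K pk) (sym (only l l<K pl))))
            (≤-trans (≤-reflexive (sym (bit-true pc))) (single c K c<K))
  where
  single : ∀ c K → c < K → bit (p c) ≤ count p K
  single c (suc K) c<1+K with m≤n⇒m<n∨m≡n (≤-pred c<1+K)
  ... | inj₁ c<K = ≤-trans (single c K c<K) (m≤m+n _ _)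
  ... | inj₂ refl = m≤n+m _ _

count₂-none : ∀ (p : ℕ → ℕ → Bool) A B → (∀ a b → ¬ T (p a b)) → sumTo (λ a → count (p a) B) A ≡ 0
count₂-none p A B none = sumTo-zero A (λ a _ → sumTo-zero B (λ b _ → bit-false (none a b)))

count₂-unique : ∀ (p : ℕ → ℕ → Bool) A B a₀ b₀ → a₀ < A → b₀ < B → T (p a₀ b₀) →
                (∀ a b → T (p a b) → a ≡ a₀ × b ≡ b₀) → sumTo (λ a → count (p a) B) A ≡ 1
count₂-unique p A B a₀ b₀ a₀<A b₀<B p₀ only = begin
  sumTo (λ a → count (p a) B) A  ≡⟨ sumTo-cong A (λ a _ → row a) ⟩
  count (_≡ᵇ a₀) A               ≡⟨ count-unique (_≡ᵇ a₀) A a₀ a₀<A (≡⇒≡ᵇ a₀ a₀ refl) (λ a _ t → ≡ᵇ⇒≡ a a₀ t) ⟩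
  1                              ∎
  where
  open ≡-Reasoning
  row : ∀ a → count (p a) B ≡ bit (a ≡ᵇ a₀)
  row a with a ≟ a₀
  ... | yes refl = trans (count-unique (p a₀) B b₀ b₀<B p₀ (λ b _ t → proj₂ (only a₀ b t)))
                         (sym (bit-true (≡⇒≡ᵇ a₀ a₀ refl)))
  ... | no a≢a₀ = trans (sumTo-zero B (λ b _ → bit-false (λ t → a≢a₀ (proj₁ (only a b t)))))
                        (sym (bit-false (λ t → a≢a₀ (≡ᵇ⇒≡ a a₀ t))))

sumFin : ∀ {N} → (Fin N → ℕ) → ℕ
sumFin {zero} f = 0
sumFin {suc N} f = f zero + sumFin (f ∘ suc)

sumFin-toℕ : ∀ N (f : ℕ → ℕ) → sumFin {N} (f ∘ toℕ) ≡ sumTo f N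
sumFin-toℕ zero f = refl
sumFin-toℕ (suc N) f = trans (cong (f 0 +_) (sumFin-toℕ N (f ∘ suc))) (sym (sumTo-shift f N))

sumFin-+ : ∀ {N} (f g : Fin N → ℕ) → sumFin (λ i → f i + g i) ≡ sumFin f + sumFin g
sumFin-+ {zero} f g = refl
sumFin-+ {suc N} f g rewrite sumFin-+ (f ∘ suc) (g ∘ suc) = interchange (f zero) (g zero) (sumFin (f ∘ suc)) (sumFin (g ∘ suc))
  where
  interchange : ∀ a b c d → (a + b) + (c + d) ≡ (a + c) + (b + d)
  interchange = solve-∀

sumFin-mono : ∀ {N} (f g : Fin N → ℕ) → (∀ i → f i ≤ g i) → sumFin f ≤ sumFin g
sumFin-mono {zero} f g h = z≤n
sumFin-mono {suc N} f g h = +-mono-≤ (h zero) (sumFin-mono (f ∘ suc) (g ∘ suc) (h ∘ suc))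

sumFin-ones : ∀ N → sumFin {N} (λ _ → 1) ≡ N
sumFin-ones zero = refl
sumFin-ones (suc N) = cong suc (sumFin-ones N)

sumFin-zero : ∀ {N} (f : Fin N → ℕ) → (∀ i → f i ≡ 0) → sumFin f ≡ 0
sumFin-zero {zero} f h = refl
sumFin-zero {suc N} f h = cong₂ _+_ (h zero) (sumFin-zero (f ∘ suc) (h ∘ suc))

sumFin-atMostOne : ∀ {N} (R : Fin N → Bool) → (∀ w x → toℕ w < toℕ x → T (R w) → T (R x) → ⊥) → sumFin (bit ∘ R) ≤ 1
sumFin-atMostOne {zero} R h = z≤n
sumFin-atMostOne {suc N} R h with T? (R zero)
... | yes R0 = ≤-reflexive (cong₂ _+_ (bit-true R0) (sumFin-zero (bit ∘ R ∘ suc) (λ x → bit-false (h zero (suc x) z<s R0))))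
... | no ¬R0 = ≤-trans (≤-reflexive (cong (_+ sumFin (bit ∘ R ∘ suc)) (bit-false ¬R0)))
                      (sumFin-atMostOne (R ∘ suc) (λ w x w<x → h (suc w) (suc x) (s<s w<x)))

sumFin-atMostTwo : ∀ {N} (R : Fin N → Bool) →
                   (∀ u w x → toℕ u < toℕ w → toℕ w < toℕ x → T (R u) → T (R w) → T (R x) → ⊥) → sumFin (bit ∘ R) ≤ 2
sumFin-atMostTwo {zero} R h = z≤n
sumFin-atMostTwo {suc N} R h with T? (R zero)
... | yes R0 = ≤-trans (≤-reflexive (cong (_+ sumFin (bit ∘ R ∘ suc)) (bit-true R0)))
                       (s≤s (sumFin-atMostOne (R ∘ suc) (λ w x w<x → h zero (suc w) (suc x) z<s (s<s w<x) R0)))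
... | no ¬R0 = ≤-trans (≤-reflexive (cong (_+ sumFin (bit ∘ R ∘ suc)) (bit-false ¬R0)))
                       (sumFin-atMostTwo (R ∘ suc) (λ u w x u<w w<x → h (suc u) (suc w) (suc x) (s<s u<w) (s<s w<x)))

select : ∀ {A : Set} {N} → (Fin N → Bool) → (Fin N → A) → List A
select {N = zero} P f = []
select {N = suc N} P f = if P zero then f zero ∷ rest else rest
  where rest = select (P ∘ suc) (f ∘ suc)

length-select : ∀ {A : Set} {N} (P : Fin N → Bool) (f : Fin N → A) → length (select P f) ≡ sumFin (bit ∘ P)
length-select {N = zero} P f = refl
length-select {N = suc N} P f with P zero
... | true = cong suc (length-select (P ∘ suc) (f ∘ suc))
... | false = length-select (P ∘ suc) (f ∘ suc)

∈-select : ∀ {A : Set} {N} (P : Fin N → Bool) (f : Fin N → A) {y} → y ∈ select P f → ∃ λ v → T (P v) × y ≡ f v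
∈-select {N = suc N} P f y∈ with P zero in P0
∈-select {N = suc N} P f (here refl) | true = zero , subst T (sym P0) _ , refl
∈-select {N = suc N} P f (there y∈) | true with ∈-select (P ∘ suc) (f ∘ suc) y∈
... | v , Pv , y≡ = suc v , Pv , y≡
∈-select {N = suc N} P f y∈ | false with ∈-select (P ∘ suc) (f ∘ suc) y∈
... | v , Pv , y≡ = suc v , Pv , y≡

module Multiplicity {A : Set} (_≟ᴬ_ : DecidableEquality A) where

  occurrences : A → List A → ℕ
  occurrences h [] = 0
  occurrences h (y ∷ ys) = bit (does (y ≟ᴬ h)) + occurrences h ys

  without : A → List A → List A
  without d [] = []
  without d (y ∷ ys) = if does (y ≟ᴬ d) then without d ys else y ∷ without d ys

  length-without : ∀ d ys → length ys ≡ occurrences d ys + length (without d ys)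
  length-without d [] = refl
  length-without d (y ∷ ys) with y ≟ᴬ d
  ... | yes _ = cong suc (length-without d ys)
  ... | no _ = trans (cong suc (length-without d ys)) (sym (+-suc _ _))

  ∈-without : ∀ d ys {y} → y ∈ without d ys → y ∈ ys × y ≢ d
  ∈-without d (x ∷ ys) y∈ with x ≟ᴬ d
  ... | yes _ = Data.Product.map₁ there (∈-without d ys y∈)
  ∈-without d (x ∷ ys) (here refl) | no x≢d = here refl , x≢d
  ∈-without d (x ∷ ys) (there y∈) | no _ = Data.Product.map₁ there (∈-without d ys y∈)

  occurrences-without : ∀ h d ys → occurrences h (without d ys) ≤ occurrences h ys
  occurrences-without h d [] = z≤n
  occurrences-without h d (y ∷ ys) with y ≟ᴬ d
  ... | yes _ = ≤-trans (occurrences-without h d ys) (m≤n+m _ _)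
  ... | no _ = +-monoʳ-≤ (bit (does (y ≟ᴬ h))) (occurrences-without h d ys)

  occurrences-select : ∀ {N} (P : Fin N → Bool) (f : Fin N → A) h →
                       occurrences h (select P f) ≡ sumFin (λ v → bit (P v ∧ does (f v ≟ᴬ h)))
  occurrences-select {zero} P f h = refl
  occurrences-select {suc N} P f h with P zero
  ... | true = cong (bit (does (f zero ≟ᴬ h)) +_) (occurrences-select (P ∘ suc) (f ∘ suc) h)
  ... | false = occurrences-select (P ∘ suc) (f ∘ suc) h

  length-≤-multiplicity : ∀ k ds → Unique ds → ∀ ys → (∀ {y} → y ∈ ys → y ∈ ds) →
                          (∀ h → occurrences h ys ≤ k) → length ys ≤ k * length ds
  length-≤-multiplicity k [] _ [] _ _ = z≤n
  length-≤-multiplicity k [] _ (y ∷ ys) ys⊆ _ with ys⊆ (here refl)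
  ... | ()
  length-≤-multiplicity k (d ∷ ds) (_ ∷ unique) ys ys⊆ mult = begin
    length ys                                      ≡⟨ length-without d ys ⟩
    occurrences d ys + length (without d ys)       ≤⟨ +-mono-≤ (mult d) rest ⟩
    k + k * length ds                              ≡⟨ sym (*-suc k (length ds)) ⟩
    k * length (d ∷ ds)                            ∎
    where
    open ≤-Reasoning
    without⊆ : ∀ {y} → y ∈ without d ys → y ∈ ds
    without⊆ y∈ with ∈-without d ys y∈
    ... | y∈ys , y≢d with ys⊆ y∈ys
    ...   | here y≡d = ⊥-elim (y≢d y≡d)
    ...   | there y∈ds = y∈ds
    rest = length-≤-multiplicity k ds unique (without d ys) without⊆ (λ h → ≤-trans (occurrences-without h d ys) (mult h))

counting-bound : ∀ {N E B C g m} r → N ≤ E + B + C → E ≤ 2 * g → C ≤ m → r * B ≤ N →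
                 (r ∸ 1) * N ≤ 2 * r * g + r * m
counting-bound {N} {E} {B} {C} {g} {m} r N≤ E≤ C≤ rB≤N = begin
  (r ∸ 1) * N             ≡⟨ trans (*-distribʳ-∸ N r 1) (cong (r * N ∸_) (*-identityˡ N)) ⟩
  r * N ∸ N               ≤⟨ m≤n+o⇒m∸n≤o (r * N) N rN≤ ⟩
  2 * r * g + r * m       ∎
  where
  open ≤-Reasoning
  rN≤ : r * N ≤ N + (2 * r * g + r * m)
  rN≤ = begin
    r * N                            ≤⟨ *-monoʳ-≤ r N≤ ⟩
    r * (E + B + C)                  ≡⟨ expand r E B C ⟩
    r * E + r * B + r * C            ≤⟨ +-mono-≤ (+-mono-≤ (*-monoʳ-≤ r E≤) rB≤N) (*-monoʳ-≤ r C≤) ⟩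
    r * (2 * g) + N + r * m          ≡⟨ regroup r g N m ⟩
    N + (2 * r * g + r * m)          ∎
    where
    expand : ∀ r E B C → r * (E + B + C) ≡ r * E + r * B + r * C
    expand = solve-∀
    regroup : ∀ r g N m → r * (2 * g) + N + r * m ≡ N + (2 * r * g + r * m)
    regroup = solve-∀

all-applyUpTo⁻ : ∀ {A : Set} (p : A → Bool) f m → T (all p (applyUpTo f m)) → ∀ k → k < m → T (p (f k))
all-applyUpTo⁻ p f m t k k<m = applyUpTo⁻ f m (all⁺ p _ t) k<m

all-applyUpTo⁺ : ∀ {A : Set} (p : A → Bool) f m → (∀ k → k < m → T (p (f k))) → T (all p (applyUpTo f m))
all-applyUpTo⁺ p f m h = all⁻ p (applyUpTo⁺₁ f m (λ {k} k<m → h k k<m))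

all-interval⁻ : ∀ (p : ℕ → Bool) a b → T (all p (interval a b)) → ∀ i → a ≤ i → i ≤ b → T (p i)
all-interval⁻ p a b t i a≤i i≤b =
  subst (T ∘ p) (m+[n∸m]≡n a≤i)
        (all-applyUpTo⁻ p (a +_) (suc (b ∸ a)) (subst (T ∘ all p) (map-upTo (a +_) (suc (b ∸ a))) t)
                        (i ∸ a) (s≤s (∸-monoˡ-≤ a i≤b)))

all-interval⁺ : ∀ (p : ℕ → Bool) a b → a ≤ b → (∀ i → a ≤ i → i ≤ b → T (p i)) → T (all p (interval a b))
all-interval⁺ p a b a≤b h =
  subst (T ∘ all p) (sym (map-upTo (a +_) (suc (b ∸ a))))
        (all-applyUpTo⁺ p (a +_) (suc (b ∸ a)) (λ k k<m → h (a + k) (m≤m+n a k) (within k (≤-pred k<m))))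
  where
  within : ∀ k → k ≤ b ∸ a → a + k ≤ b
  within k k≤b-a = ≤-trans (+-monoʳ-≤ a k≤b-a) (≤-reflexive (m+[n∸m]≡n a≤b))

EdgeFn : Set
EdgeFn = ℕ → ℕ → Bool

SymmetricFn : EdgeFn → Set
SymmetricFn e = ∀ i j → e i j ≡ e j i

Twins : ℕ → EdgeFn → ℕ → ℕ → Set
Twins n e x y = ∀ z → z < n → z ≢ x → z ≢ y → e x z ≡ e y z

-- The boolean test of `twin` from Defs, for an arbitrary edge function:
-- twin G is definitionally twinB n (edge G).
twinTest : EdgeFn → ℕ → ℕ → ℕ → Bool
twinTest e x y z = (z ≡ᵇ x) ∨ (z ≡ᵇ y) ∨ not (e x z xor e y z)

twinB : ℕ → EdgeFn → ℕ → ℕ → Bool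
twinB n e x y = all (twinTest e x y) (upTo n)

not-xor⇒≡ : ∀ a b → T (not (a xor b)) → a ≡ b
not-xor⇒≡ true true _ = refl
not-xor⇒≡ false false _ = refl

≡⇒not-xor : ∀ a b → a ≡ b → T (not (a xor b))
≡⇒not-xor true true _ = _
≡⇒not-xor false false _ = _

twinTest-sound : ∀ e x y z → T (twinTest e x y z) → z ≢ x → z ≢ y → e x z ≡ e y z
twinTest-sound e x y z t z≢x z≢y with z ≡ᵇ x in z=x | z ≡ᵇ y in z=y
... | true | _ = ⊥-elim (z≢x (≡ᵇ⇒≡ z x (subst T (sym z=x) _)))
... | false | true = ⊥-elim (z≢y (≡ᵇ⇒≡ z y (subst T (sym z=y) _)))
... | false | false = not-xor⇒≡ (e x z) (e y z) t

twinTest-complete : ∀ e x y z → (z ≢ x → z ≢ y → e x z ≡ e y z) → T (twinTest e x y z)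
twinTest-complete e x y z agree with z ≡ᵇ x in z=x | z ≡ᵇ y in z=y
... | true | _ = _
... | false | true = _
... | false | false =
  ≡⇒not-xor _ _ (agree (λ z≡x → subst T z=x (≡⇒≡ᵇ z x z≡x)) (λ z≡y → subst T z=y (≡⇒≡ᵇ z y z≡y)))

twinB-sound : ∀ n e x y → T (twinB n e x y) → Twins n e x y
twinB-sound n e x y t z z<n = twinTest-sound e x y z (all-applyUpTo⁻ (twinTest e x y) id n t z z<n)

twinB-complete : ∀ n e x y → Twins n e x y → T (twinB n e x y)
twinB-complete n e x y tw = all-applyUpTo⁺ (twinTest e x y) id n (λ z z<n → twinTest-complete e x y z (tw z z<n))

Twins-refl : ∀ n e x → Twins n e x x
Twins-refl n e x z _ _ _ = refl

Twins-sym : ∀ n e x y → Twins n e x y → Twins n e y x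
Twins-sym n e x y tw z z<n z≢y z≢x = sym (tw z z<n z≢x z≢y)

Twins-trans : ∀ n e → SymmetricFn e → ∀ x y z → x < n → z < n → Twins n e x y → Twins n e y z → Twins n e x z
Twins-trans n e sym-e x y z x<n z<n x∼y y∼z w w<n w≢x w≢z with w ≟ y
... | no w≢y = trans (x∼y w w<n w≢x w≢y) (y∼z w w<n w≢y w≢z)
... | yes refl with x ≟ z
...   | yes refl = refl
...   | no x≢z = begin
  e x w  ≡⟨ sym-e x w ⟩
  e w x  ≡⟨ y∼z x x<n (≢-sym w≢x) x≢z ⟩
  e z x  ≡⟨ sym-e z x ⟩
  e x z  ≡⟨ x∼y z z<n (≢-sym x≢z) (≢-sym w≢z) ⟩
  e w z  ≡⟨ sym-e w z ⟩
  e z w  ∎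
  where open ≡-Reasoning

-- Ignoring the column of v: x ∼ y in this graph means that x and y
-- are twins except possibly for their adjacency to v.
eraseCol : ℕ → EdgeFn → EdgeFn
eraseCol v e a z = if z ≡ᵇ v then false else e a z

TwinsApartFrom : ℕ → EdgeFn → ℕ → ℕ → ℕ → Set
TwinsApartFrom n e v x y = ∀ z → z < n → z ≢ x → z ≢ y → z ≢ v → e x z ≡ e y z

Twins-eraseCol⁻ : ∀ n e v x y → Twins n (eraseCol v e) x y → TwinsApartFrom n e v x y
Twins-eraseCol⁻ n e v x y tw z z<n z≢x z≢y z≢v with tw z z<n z≢x z≢y
... | agree with z ≡ᵇ v in z=v
...   | true = ⊥-elim (z≢v (≡ᵇ⇒≡ z v (subst T (sym z=v) _)))
...   | false = agree

Twins-eraseCol⁺ : ∀ n e v x y → TwinsApartFrom n e v x y → Twins n (eraseCol v e) x y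
Twins-eraseCol⁺ n e v x y tw z z<n z≢x z≢y with z ≡ᵇ v in z=v
... | true = refl
... | false = tw z z<n z≢x z≢y (λ z≡v → subst T z=v (≡⇒≡ᵇ z v z≡v))

Twins-glue : ∀ n e v v' x y → v ≢ v' → TwinsApartFrom n e v x y → TwinsApartFrom n e v' x y → Twins n e x y
Twins-glue n e v v' x y v≢v' apart apart' z z<n z≢x z≢y with z ≟ v
... | yes refl = apart' z z<n z≢x z≢y v≢v'
... | no z≢v = apart z z<n z≢x z≢y z≢v

lookupℕ-in : ∀ {A : Set} {n} (d : A) (xs : Vec A n) i (i<n : i < n) → lookupℕ d xs i ≡ lookup xs (fromℕ< i<n)
lookupℕ-in d (x ∷ xs) zero i<n = refl
lookupℕ-in d (x ∷ xs) (suc i) i<n = lookupℕ-in d xs i (≤-pred i<n)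

lookupℕ-out : ∀ {A : Set} {n} (d : A) (xs : Vec A n) i → n ≤ i → lookupℕ d xs i ≡ d
lookupℕ-out d Vec.[] i _ = refl
lookupℕ-out d (x ∷ xs) (suc i) n≤i = lookupℕ-out d xs i (≤-pred n≤i)

lookupℕ-replicate : ∀ {A : Set} (d : A) n j → lookupℕ d (replicate n d) j ≡ d
lookupℕ-replicate d zero j = refl
lookupℕ-replicate d (suc n) zero = refl
lookupℕ-replicate d (suc n) (suc j) = lookupℕ-replicate d n j

lookupℕ-map : ∀ {A B : Set} {n} (f : A → B) d d' → f d ≡ d' → (xs : Vec A n) → ∀ i →
              lookupℕ d' (Vec.map f xs) i ≡ f (lookupℕ d xs i)
lookupℕ-map f d d' fd≡d' Vec.[] i = sym fd≡d'
lookupℕ-map f d d' fd≡d' (x ∷ xs) zero = refl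
lookupℕ-map f d d' fd≡d' (x ∷ xs) (suc i) = lookupℕ-map f d d' fd≡d' xs i

edge-in : ∀ {n} (G : Adj n) i j (i<n : i < n) (j<n : j < n) → edge G i j ≡ lookup (lookup G (fromℕ< i<n)) (fromℕ< j<n)
edge-in G i j i<n j<n =
  trans (cong (λ row → lookupℕ false row j) (lookupℕ-in _ G i i<n)) (lookupℕ-in false (lookup G (fromℕ< i<n)) j j<n)

edge-out : ∀ {n} (G : Adj n) i j → n ≤ i ⊎ n ≤ j → edge G i j ≡ false
edge-out {n} G i j (inj₁ n≤i) =
  trans (cong (λ row → lookupℕ false row j) (lookupℕ-out _ G i n≤i)) (lookupℕ-replicate false n j)
edge-out {n} G i j (inj₂ n≤j) with i <? n
... | yes i<n = trans (cong (λ row → lookupℕ false row j) (lookupℕ-in _ G i i<n)) (lookupℕ-out false (lookup G (fromℕ< i<n)) j n≤j)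
... | no i≮n = edge-out G i j (inj₁ (≮⇒≥ i≮n))

edge-symmetric : ∀ {n} (G : Adj n) → Symmetric G → SymmetricFn (edge G)
edge-symmetric {n} G symG i j with i <? n | j <? n
... | yes i<n | yes j<n =
  trans (edge-in G i j i<n j<n) (trans (symG _ _) (sym (edge-in G j i j<n i<n)))
... | no i≮n | _ = trans (edge-out G i j (inj₁ (≮⇒≥ i≮n))) (sym (edge-out G j i (inj₂ (≮⇒≥ i≮n))))
... | _ | no j≮n = trans (edge-out G i j (inj₂ (≮⇒≥ j≮n))) (sym (edge-out G j i (inj₁ (≮⇒≥ j≮n))))

-- skip v i: the vertex of G that becomes vertex i of G - v
-- (i itself when i < v, and i + 1 otherwise).
skip : ℕ → ℕ → ℕ
skip zero i = suc i
skip (suc v) zero = zero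
skip (suc v) (suc i) = suc (skip v i)

skip-below : ∀ v i → i < v → skip v i ≡ i
skip-below (suc v) zero _ = refl
skip-below (suc v) (suc i) i<v = cong suc (skip-below v i (≤-pred i<v))

skip-above : ∀ v i → v ≤ i → skip v i ≡ suc i
skip-above zero i _ = refl
skip-above (suc v) (suc i) v≤i = cong suc (skip-above v i (≤-pred v≤i))

skip-suc : ∀ v i → suc i ≢ v → skip v (suc i) ≡ suc (skip v i)
skip-suc zero i _ = refl
skip-suc (suc zero) zero ne = ⊥-elim (ne refl)
skip-suc (suc (suc v)) zero _ = refl
skip-suc (suc v) (suc i) ne = cong suc (skip-suc v i (ne ∘ cong suc))

skip-onto : ∀ v z → z ≢ v → ∃ λ i → skip v i ≡ z
skip-onto zero zero ne = ⊥-elim (ne refl)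
skip-onto zero (suc z) _ = z , refl
skip-onto (suc v) zero _ = zero , refl
skip-onto (suc v) (suc z) ne with skip-onto v z (ne ∘ cong suc)
... | i , eq = suc i , cong suc eq

skip-increasing : ∀ v i → skip v i < skip v (suc i)
skip-increasing zero i = ≤-refl
skip-increasing (suc v) zero = s≤s z≤n
skip-increasing (suc v) (suc i) = s≤s (skip-increasing v i)

skip-bound : ∀ v i m → i < m → skip v i < suc m
skip-bound v i m i<m = s≤s (≤-trans (skip≤ v i) i<m)
  where
  skip≤ : ∀ v i → skip v i ≤ suc i
  skip≤ zero i = ≤-refl
  skip≤ (suc v) zero = z≤n
  skip≤ (suc v) (suc i) = s≤s (skip≤ v i)

skip-bound⁻ : ∀ v i m → v ≤ m → skip v i < suc m → i < m
skip-bound⁻ zero i m _ (s≤s i<m) = i<m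
skip-bound⁻ (suc v) zero (suc m) _ _ = s≤s z≤n
skip-bound⁻ (suc v) (suc i) (suc m) (s≤s v≤m) (s≤s lt) = s≤s (skip-bound⁻ v i m v≤m lt)

lookupℕ-removeAt : ∀ {A : Set} {n} (d : A) (xs : Vec A (suc n)) (v : Fin (suc n)) i →
                   lookupℕ d (removeAt xs v) i ≡ lookupℕ d xs (skip (toℕ v) i)
lookupℕ-removeAt d (x ∷ xs) zero i = refl
lookupℕ-removeAt d (x ∷ y ∷ xs) (suc v) zero = refl
lookupℕ-removeAt d (x ∷ y ∷ xs) (suc v) (suc i) = lookupℕ-removeAt d (y ∷ xs) v i

removeAt-replicate : ∀ {A : Set} {n} (d : A) (v : Fin (suc n)) → removeAt (replicate (suc n) d) v ≡ replicate n d
removeAt-replicate d zero = refl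
removeAt-replicate {n = suc n} d (suc v) = cong (d ∷_) (removeAt-replicate d v)

edge-delete : ∀ {n} (G : Adj (suc n)) (v : Fin (suc n)) i j →
              edge (delete G v) i j ≡ edge G (skip (toℕ v) i) (skip (toℕ v) j)
edge-delete {n} G v i j = begin
  lookupℕ false (lookupℕ (replicate n false) (Vec.map (λ row → removeAt row v) (removeAt G v)) i) j
    ≡⟨ cong (λ row → lookupℕ false row j)
            (lookupℕ-map (λ row → removeAt row v) _ _ (removeAt-replicate false v) (removeAt G v) i) ⟩
  lookupℕ false (removeAt (lookupℕ (replicate (suc n) false) (removeAt G v) i) v) j
    ≡⟨ lookupℕ-removeAt false (lookupℕ (replicate (suc n) false) (removeAt G v) i) v j ⟩
  lookupℕ false (lookupℕ (replicate (suc n) false) (removeAt G v) i) (skip (toℕ v) j)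
    ≡⟨ cong (λ row → lookupℕ false row (skip (toℕ v) j)) (lookupℕ-removeAt _ G v i) ⟩
  edge G (skip (toℕ v) i) (skip (toℕ v) j) ∎
  where open ≡-Reasoning

-- The weight |B| - 2 (counted when |B| ≥ 3) of B = {a, …, a + d}, and the number
-- of k with k, k + 1, k + 2 ∈ B ⊆ [N], are both d - 1.
blockSize-weight : ∀ d → (if 3 ≤ᵇ suc d then suc d ∸ 2 else 0) ≡ d ∸ 1
blockSize-weight zero = refl
blockSize-weight (suc zero) = refl
blockSize-weight (suc (suc d)) = refl

window-count : ∀ a d N → a + d < N → count (λ k → (a ≤ᵇ k) ∧ (suc (suc k) ≤ᵇ a + d)) N ≡ d ∸ 1
window-count a zero N _ = sumTo-zero N (λ k _ → bit-false (λ t → <⇒≱ (window t) (≤-reflexive (+-identityʳ a))))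
  where
  window : ∀ {k} → T ((a ≤ᵇ k) ∧ (suc (suc k) ≤ᵇ a + 0)) → a < a + 0
  window {k} t = ≤-trans (s≤s (≤-trans (≤ᵇ⇒≤ a k (∧-fst (a ≤ᵇ k) t)) (n≤1+n k)))
                         (≤ᵇ⇒≤ (suc (suc k)) (a + 0) (∧-snd (a ≤ᵇ k) t))
window-count a (suc d) N a+d+1<N =
  count-interval _ a d N (≤-trans (+-monoʳ-≤ a (n≤1+n d)) (<⇒≤ a+d+1<N)) inside onto
  where
  inside : ∀ k → T ((a ≤ᵇ k) ∧ (suc (suc k) ≤ᵇ a + suc d)) → a ≤ k × k < a + d
  inside k t = ≤ᵇ⇒≤ a k (∧-fst (a ≤ᵇ k) t) ,
               ≤-pred (≤-trans (≤ᵇ⇒≤ (suc (suc k)) (a + suc d) (∧-snd (a ≤ᵇ k) t)) (≤-reflexive (+-suc a d)))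
  onto : ∀ k → a ≤ k → k < a + d → T ((a ≤ᵇ k) ∧ (suc (suc k) ≤ᵇ a + suc d))
  onto k a≤k k<a+d = ∧-intro (≤⇒≤ᵇ a≤k) (≤⇒≤ᵇ (≤-trans (s≤s k<a+d) (≤-reflexive (sym (+-suc a d)))))

sum-filterᵇ : ∀ {A : Set} (p : A → Bool) (f : A → ℕ) xs →
              sum (map f (filterᵇ p xs)) ≡ sum (map (λ x → if p x then f x else 0) xs)
sum-filterᵇ p f [] = refl
sum-filterᵇ p f (x ∷ xs) with p x
... | true = cong (f x +_) (sum-filterᵇ p f xs)
... | false = sum-filterᵇ p f xs

sum-concatMap : ∀ {A B : Set} (f : B → ℕ) (g : A → List B) xs →
                sum (map f (concatMap g xs)) ≡ sum (map (λ x → sum (map f (g x))) xs)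
sum-concatMap f g [] = refl
sum-concatMap f g (x ∷ xs) =
  trans (cong sum (map-++ f (g x) (concatMap g xs)))
        (trans (sum-++ (map f (g x)) _) (cong (sum (map f (g x)) +_) (sum-concatMap f g xs)))

sum-applyUpTo : ∀ (f g : ℕ → ℕ) K → sum (map f (applyUpTo g K)) ≡ sumTo (f ∘ g) K
sum-applyUpTo f g zero = refl
sum-applyUpTo f g (suc K) = trans (cong (f (g 0) +_) (sum-applyUpTo f (g ∘ suc) K)) (sym (sumTo-shift (f ∘ g) K))

blockWeight : ∀ {n} → Adj n → ℕ → ℕ → ℕ
blockWeight G a b = if isBlock G a b then (if 3 ≤ᵇ suc (b ∸ a) then suc (b ∸ a) ∸ 2 else 0) else 0

excess-sum : ∀ {n} (G : Adj n) → excess G ≡ sumTo (λ a → sumTo (blockWeight G a) n) n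
excess-sum {n} G = begin
  excess G
    ≡⟨ sum-filterᵇ (λ p → 3 ≤ᵇ suc (proj₂ p ∸ proj₁ p)) (λ p → suc (proj₂ p ∸ proj₁ p) ∸ 2) (blocks G) ⟩
  _ ≡⟨ sum-filterᵇ (λ p → isBlock G (proj₁ p) (proj₂ p)) _ pairs ⟩
  sum (map weight pairs)
    ≡⟨ sum-concatMap weight (λ a → map (a ,_) (upTo n)) (upTo n) ⟩
  sum (map (λ a → sum (map weight (map (a ,_) (upTo n)))) (upTo n))
    ≡⟨ cong sum (map-cong (λ a → trans (cong sum (sym (map-∘ (upTo n)))) (sum-applyUpTo (blockWeight G a) id n)) (upTo n)) ⟩
  sum (map (λ a → sumTo (blockWeight G a) n) (upTo n))
    ≡⟨ sum-applyUpTo _ id n ⟩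
  sumTo (λ a → sumTo (blockWeight G a) n) n ∎
  where
  open ≡-Reasoning
  pairs : List (ℕ × ℕ)
  pairs = concatMap (λ a → map (a ,_) (upTo n)) (upTo n)
  weight : ℕ × ℕ → ℕ
  weight (a , b) = blockWeight G a b

middleOf : ∀ {n} → Adj n → ℕ → Bool
middleOf {n} G k = (suc (suc k) <ᵇ n) ∧ (twin G k (suc k) ∧ twin G (suc k) (suc (suc k)))

-- Homogeneous blocks of a graph G on [n] are exactly the maximal runs of links
-- t ∼ t + 1; counting, for each block, the middle positions it contains shows that
-- the excess of G is its number of middle positions.
module Blocks {n} (G : Adj n) (symG : SymmetricFn (edge G)) where

  Link : ℕ → Set
  Link t = T (twin G t (suc t))

  Linked : ℕ → ℕ → Set
  Linked a b = ∀ t → a ≤ t → t < b → Link t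

  Linked⇒Twins : ∀ a b → b < n → Linked a b → ∀ x y → a ≤ x → x ≤ y → y ≤ b → Twins n (edge G) x y
  Linked⇒Twins a b b<n linked x y a≤x x≤y y≤b with m≤n⇒∃[o]m+o≡n x≤y
  ... | d , refl = chain d y≤b
    where
    chain : ∀ d → x + d ≤ b → Twins n (edge G) x (x + d)
    chain zero _ = subst (Twins n (edge G) x) (sym (+-identityʳ x)) (Twins-refl n (edge G) x)
    chain (suc d) x+d+1≤b =
      subst (Twins n (edge G) x) (sym (+-suc x d))
        (Twins-trans n (edge G) symG x (x + d) (suc (x + d))
          (≤-<-trans (m≤m+n x d) x+d<n) (≤-<-trans x+d<b b<n)
          (chain d (<⇒≤ x+d<b))
          (twinB-sound n (edge G) (x + d) (suc (x + d)) (linked (x + d) (≤-trans a≤x (m≤m+n x d)) x+d<b)))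
      where
      x+d<b : x + d < b
      x+d<b = ≤-trans (≤-reflexive (sym (+-suc x d))) x+d+1≤b
      x+d<n : x + d < n
      x+d<n = <-trans x+d<b b<n

  pairwise⇒Linked : ∀ a b → T (pairwiseTwin G a b) → Linked a b
  pairwise⇒Linked a b pw t a≤t t<b =
    all-interval⁻ (twin G t) a b
      (all-interval⁻ (λ i → all (twin G i) (interval a b)) a b pw t a≤t (<⇒≤ t<b))
      (suc t) (m≤n⇒m≤1+n a≤t) t<b

  Linked⇒pairwise : ∀ a b → a ≤ b → b < n → Linked a b → T (pairwiseTwin G a b)
  Linked⇒pairwise a b a≤b b<n linked =
    all-interval⁺ _ a b a≤b λ i a≤i i≤b →
      all-interval⁺ _ a b a≤b λ j a≤j j≤b →
        twinB-complete n (edge G) i j (twins i j a≤i i≤b a≤j j≤b)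
    where
    twins : ∀ i j → a ≤ i → i ≤ b → a ≤ j → j ≤ b → Twins n (edge G) i j
    twins i j a≤i i≤b a≤j j≤b with ≤-total i j
    ... | inj₁ i≤j = Linked⇒Twins a b b<n linked i j a≤i i≤j j≤b
    ... | inj₂ j≤i = Twins-sym n (edge G) j i (Linked⇒Twins a b b<n linked j i a≤j j≤i i≤b)

  Linked-extendˡ : ∀ a b → Linked (suc a) b → Link a → Linked a b
  Linked-extendˡ a b linked link t a≤t t<b with m≤n⇒m<n∨m≡n a≤t
  ... | inj₁ a<t = linked t a<t t<b
  ... | inj₂ refl = link

  Linked-extendʳ : ∀ a b → Linked a b → Link b → Linked a (suc b)
  Linked-extendʳ a b linked link t a≤t t<b+1 with m≤n⇒m<n∨m≡n (≤-pred t<b+1)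
  ... | inj₁ t<b = linked t a≤t t<b
  ... | inj₂ refl = link

  record Run (a b : ℕ) : Set where
    field
      a≤b : a ≤ b
      b<n : b < n
      linked : Linked a b
      leftEnd : a ≡ 0 ⊎ ¬ Link (a ∸ 1)
      rightEnd : suc b ≡ n ⊎ ¬ Link b

  -- Maximality of a block means the run can be extended by a link at neither end.
  block⇒Run : ∀ a b → T (isBlock G a b) → Run a b
  block⇒Run a b blk = record
    { a≤b = a≤b
    ; b<n = b<n
    ; linked = linked
    ; leftEnd = leftEnd a (∧-fst ((a ≡ᵇ 0) ∨ not (pairwiseTwin G (a ∸ 1) b)) ends) linked a≤b
    ; rightEnd = rightEnd
    }
    where
    rest₁ = ∧-snd (a ≤ᵇ b) blk
    rest₂ = ∧-snd (b <ᵇ n) rest₁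
    ends = ∧-snd (pairwiseTwin G a b) rest₂
    a≤b = ≤ᵇ⇒≤ a b (∧-fst (a ≤ᵇ b) blk)
    b<n = <ᵇ⇒< b n (∧-fst (b <ᵇ n) rest₁)
    linked = pairwise⇒Linked a b (∧-fst (pairwiseTwin G a b) rest₂)
    leftEnd : ∀ a → T ((a ≡ᵇ 0) ∨ not (pairwiseTwin G (a ∸ 1) b)) → Linked a b → a ≤ b →
              a ≡ 0 ⊎ ¬ Link (a ∸ 1)
    leftEnd zero _ _ _ = inj₁ refl
    leftEnd (suc a) unextendable linked a+1≤b = inj₂ λ link →
      not-elim _ unextendable
        (Linked⇒pairwise a b (≤-trans (n≤1+n a) a+1≤b) b<n (Linked-extendˡ a b linked link))
    rightEnd : suc b ≡ n ⊎ ¬ Link b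
    rightEnd with suc b ≟ n | ∨-elim (suc b ≡ᵇ n) (∧-snd ((a ≡ᵇ 0) ∨ not (pairwiseTwin G (a ∸ 1) b)) ends)
    ... | yes b+1≡n | _ = inj₁ b+1≡n
    ... | no b+1≢n | inj₁ b+1=n = ⊥-elim (b+1≢n (≡ᵇ⇒≡ (suc b) n b+1=n))
    ... | no b+1≢n | inj₂ unextendable = inj₂ λ link →
      not-elim _ unextendable
        (Linked⇒pairwise a (suc b) (m≤n⇒m≤1+n a≤b) (≤∧≢⇒< b<n b+1≢n) (Linked-extendʳ a b linked link))

  Run⇒block : ∀ a b → Run a b → T (isBlock G a b)
  Run⇒block a b run =
    ∧-intro (≤⇒≤ᵇ a≤b) (∧-intro (<⇒<ᵇ b<n) (∧-intro (Linked⇒pairwise a b a≤b b<n linked)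
      (∧-intro (left a a≤b leftEnd) (right rightEnd))))
    where
    open Run run
    left : ∀ a → a ≤ b → a ≡ 0 ⊎ ¬ Link (a ∸ 1) → T ((a ≡ᵇ 0) ∨ not (pairwiseTwin G (a ∸ 1) b))
    left zero _ _ = _
    left (suc a) a<b (inj₂ unlinked) = not-intro _ λ pw → unlinked (pairwise⇒Linked a b pw a ≤-refl a<b)
    right : suc b ≡ n ⊎ ¬ Link b → T ((suc b ≡ᵇ n) ∨ not (pairwiseTwin G a (suc b)))
    right (inj₁ b+1≡n) = ∨-introˡ _ (≡⇒≡ᵇ (suc b) n b+1≡n)
    right (inj₂ unlinked) =
      ∨-introʳ (suc b ≡ᵇ n) (not-intro _ λ pw → unlinked (pairwise⇒Linked a (suc b) pw b a≤b ≤-refl))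

  Run-start : ∀ {a b a' b'} → Run a b → Run a' b' → a < a' → a' ≤ b → ⊥
  Run-start {a' = suc c} run run' a<a' a'≤b with Run.leftEnd run'
  ... | inj₂ unlinked = unlinked (Run.linked run c (≤-pred a<a') a'≤b)

  Run-end : ∀ {a b a' b'} → Run a b → Run a' b' → b < b' → a' ≤ b → ⊥
  Run-end run run' b<b' a'≤b with Run.rightEnd run
  ... | inj₁ b+1≡n = <-irrefl b+1≡n (≤-<-trans b<b' (Run.b<n run'))
  ... | inj₂ unlinked = unlinked (Run.linked run' _ a'≤b b<b')

  Run-unique : ∀ {a b a' b'} j → Run a b → Run a' b' → a ≤ j → j < b → a' ≤ j → j < b' → a ≡ a' × b ≡ b'
  Run-unique {a} {b} {a'} {b'} j run run' a≤j j<b a'≤j j<b' = sameStart , sameEnd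
    where
    sameStart : a ≡ a'
    sameStart with <-cmp a a'
    ... | tri< a<a' _ _ = ⊥-elim (Run-start run run' a<a' (≤-trans a'≤j (<⇒≤ j<b)))
    ... | tri≈ _ a≡a' _ = a≡a'
    ... | tri> _ _ a'<a = ⊥-elim (Run-start run' run a'<a (≤-trans a≤j (<⇒≤ j<b')))
    sameEnd : b ≡ b'
    sameEnd with <-cmp b b'
    ... | tri< b<b' _ _ = ⊥-elim (Run-end run run' b<b' (≤-trans a'≤j (<⇒≤ j<b)))
    ... | tri≈ _ b≡b' _ = b≡b'
    ... | tri> _ _ b'<b = ⊥-elim (Run-end run' run b'<b (≤-trans a≤j (<⇒≤ j<b')))

  Run-continues : ∀ {a b} t → Run a b → t ≤ b → suc t < n → Link t → t < b
  Run-continues t run t≤b t+1<n link with m≤n⇒m<n∨m≡n t≤b | Run.rightEnd run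
  ... | inj₁ t<b | _ = t<b
  ... | inj₂ refl | inj₁ t+1≡n = ⊥-elim (<-irrefl t+1≡n t+1<n)
  ... | inj₂ refl | inj₂ unlinked = ⊥-elim (unlinked link)

  runStart : ℕ → ℕ
  runStart zero = zero
  runStart (suc t) = if twin G t (suc t) then runStart t else suc t

  runStart-spec : ∀ t → runStart t ≤ t × Linked (runStart t) t × (runStart t ≡ 0 ⊎ ¬ Link (runStart t ∸ 1))
  runStart-spec zero = z≤n , (λ t _ ()) , inj₁ refl
  runStart-spec (suc t) with twin G t (suc t) in link | runStart-spec t
  ... | true | start≤t , linked , leftEnd =
    m≤n⇒m≤1+n start≤t , Linked-extendʳ _ t linked (subst T (sym link) _) , leftEnd
  ... | false | _ = ≤-refl , (λ s t+1≤s s<t+1 → ⊥-elim (<⇒≱ s<t+1 t+1≤s)) , inj₂ (subst T link)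

  runEnd : ℕ → ℕ → ℕ
  runEnd t zero = t
  runEnd t (suc f) = if twin G t (suc t) then runEnd (suc t) f else t

  runEnd-spec : ∀ t f → t ≤ runEnd t f × runEnd t f ≤ t + f × Linked t (runEnd t f) ×
                        (runEnd t f ≡ t + f ⊎ ¬ Link (runEnd t f))
  runEnd-spec t zero = ≤-refl , m≤m+n t 0 , (λ s t≤s s<t → ⊥-elim (<⇒≱ s<t t≤s)) , inj₁ (sym (+-identityʳ t))
  runEnd-spec t (suc f) with twin G t (suc t) in link | runEnd-spec (suc t) f
  ... | true | t+1≤end , end≤ , linked , rightEnd =
    ≤-trans (n≤1+n t) t+1≤end , ≤-trans end≤ (≤-reflexive (sym (+-suc t f))) ,
    Linked-extendˡ t _ linked (subst T (sym link) _) , reindex rightEnd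
    where
    reindex : runEnd (suc t) f ≡ suc t + f ⊎ ¬ Link (runEnd (suc t) f) →
              runEnd (suc t) f ≡ t + suc f ⊎ ¬ Link (runEnd (suc t) f)
    reindex (inj₁ eq) = inj₁ (trans eq (sym (+-suc t f)))
    reindex (inj₂ unlinked) = inj₂ unlinked
  ... | false | _ = ≤-refl , m≤m+n t (suc f) , (λ s t≤s s<t → ⊥-elim (<⇒≱ s<t t≤s)) , inj₂ (subst T link)

  runAround : ∀ k → k < n → ∃ λ a → ∃ λ b → Run a b × a ≤ k × k ≤ b
  runAround k k<n with runStart-spec k | runEnd-spec k (n ∸ suc k)
  ... | start≤k , linkedˡ , leftEnd | k≤end , end≤ , linkedʳ , rightEnd =
    runStart k , runEnd k f , run , start≤k , k≤end
    where
    f = n ∸ suc k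
    k+f+1≡n : suc (k + f) ≡ n
    k+f+1≡n = m+[n∸m]≡n k<n
    linked : Linked (runStart k) (runEnd k f)
    linked t start≤t t<end with t <? k
    ... | yes t<k = linkedˡ t start≤t t<k
    ... | no t≮k = linkedʳ t (≮⇒≥ t≮k) t<end
    run : Run (runStart k) (runEnd k f)
    run = record
      { a≤b = ≤-trans start≤k k≤end
      ; b<n = ≤-<-trans end≤ (≤-reflexive k+f+1≡n)
      ; linked = linked
      ; leftEnd = leftEnd
      ; rightEnd = Data.Sum.map₁ (λ end≡ → trans (cong suc end≡) k+f+1≡n) rightEnd
      }

  middle : ℕ → Bool
  middle = middleOf G

  covers : ℕ → ℕ → ℕ → Bool
  covers k a b = isBlock G a b ∧ ((a ≤ᵇ k) ∧ (suc (suc k) ≤ᵇ b))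

  covers⇒Run : ∀ k a b → T (covers k a b) → Run a b × a ≤ k × suc (suc k) ≤ b
  covers⇒Run k a b t =
    block⇒Run a b (∧-fst (isBlock G a b) t) ,
    ≤ᵇ⇒≤ a k (∧-fst (a ≤ᵇ k) window) , ≤ᵇ⇒≤ (suc (suc k)) b (∧-snd (a ≤ᵇ k) window)
    where window = ∧-snd (isBlock G a b) t

  coveringBlocks : ∀ k → sumTo (λ a → count (covers k a) n) n ≡ bit (middle k)
  coveringBlocks k with T? (middle k)
  ... | no notMiddle = trans (count₂-none (covers k) n n (λ a b t → notMiddle (isMiddle a b t)))
                             (sym (bit-false notMiddle))
    where
    isMiddle : ∀ a b → T (covers k a b) → T (middle k)
    isMiddle a b t with covers⇒Run k a b t
    ... | run , a≤k , k+2≤b =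
      ∧-intro (<⇒<ᵇ (≤-<-trans k+2≤b (Run.b<n run)))
        (∧-intro (Run.linked run k a≤k (≤-trans (n≤1+n (suc k)) k+2≤b))
                 (Run.linked run (suc k) (m≤n⇒m≤1+n a≤k) k+2≤b))
  ... | yes mid with runAround k (<-trans (m<n⇒m<1+n (n<1+n k)) k+2<n)
    where k+2<n = <ᵇ⇒< (suc (suc k)) n (∧-fst (suc (suc k) <ᵇ n) mid)
  ...   | a , b , run , a≤k , k≤b =
    trans (count₂-unique (covers k) n n a b (≤-<-trans a≤k (≤-<-trans k≤b b<n)) b<n
                         (∧-intro (Run⇒block a b run) (∧-intro (≤⇒≤ᵇ a≤k) (≤⇒≤ᵇ k+2≤b))) only)
          (sym (bit-true mid))
    where
    b<n = Run.b<n run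
    k+2<n = <ᵇ⇒< (suc (suc k)) n (∧-fst (suc (suc k) <ᵇ n) mid)
    links = ∧-snd (suc (suc k) <ᵇ n) mid
    k<b : k < b
    k<b = Run-continues k run k≤b (<-trans (n<1+n (suc k)) k+2<n) (∧-fst (twin G k (suc k)) links)
    k+2≤b : suc (suc k) ≤ b
    k+2≤b = Run-continues (suc k) run k<b k+2<n (∧-snd (twin G k (suc k)) links)
    only : ∀ a' b' → T (covers k a' b') → a' ≡ a × b' ≡ b
    only a' b' t with covers⇒Run k a' b' t
    ... | run' , a'≤k , k+2≤b' = Run-unique k run' run a'≤k (≤-trans (n≤1+n (suc k)) k+2≤b') a≤k k<b

  blockWeight-count : ∀ a b → blockWeight G a b ≡ count (λ k → covers k a b) n
  blockWeight-count a b with isBlock G a b in blk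
  ... | false = sym (sumTo-zero n (λ _ _ → refl))
  ... | true = begin
    (if 3 ≤ᵇ suc (b ∸ a) then suc (b ∸ a) ∸ 2 else 0)        ≡⟨ blockSize-weight (b ∸ a) ⟩
    b ∸ a ∸ 1                                                 ≡⟨ sym (window-count a (b ∸ a) n (≤-<-trans (≤-reflexive a+[b-a]≡b) b<n)) ⟩
    count (λ k → (a ≤ᵇ k) ∧ (suc (suc k) ≤ᵇ a + (b ∸ a))) n  ≡⟨ cong (λ c → count (λ k → (a ≤ᵇ k) ∧ (suc (suc k) ≤ᵇ c)) n) a+[b-a]≡b ⟩
    count (λ k → (a ≤ᵇ k) ∧ (suc (suc k) ≤ᵇ b)) n            ∎
    where
    open ≡-Reasoning
    run = block⇒Run a b (subst T (sym blk) _)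
    b<n = Run.b<n run
    a+[b-a]≡b = m+[n∸m]≡n (Run.a≤b run)

  excess≡middles : excess G ≡ count middle n
  excess≡middles = begin
    excess G                                                                   ≡⟨ excess-sum G ⟩
    sumTo (λ a → sumTo (blockWeight G a) n) n                                  ≡⟨ sumTo-cong n (λ a _ → sumTo-cong n (λ b _ → blockWeight-count a b)) ⟩
    sumTo (λ a → sumTo (λ b → count (λ k → covers k a b) n) n) n               ≡⟨ sumTo-cong n (λ a _ → sumTo-swap (λ b k → bit (covers k a b)) n n) ⟩
    sumTo (λ a → sumTo (λ k → count (covers k a) n) n) n                       ≡⟨ sumTo-swap (λ a k → count (covers k a) n) n n ⟩
    sumTo (λ k → sumTo (λ a → count (covers k a) n) n) n                       ≡⟨ sumTo-cong n (λ k _ → coveringBlocks k) ⟩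
    count middle n                                                             ∎
    where open ≡-Reasoning

-- How deleting a vertex v changes the middle positions.  A pair j, j + 1 is
-- critical for v when v is the only vertex distinguishing j and j + 1.
module Deletion {n} (G : Adj (suc n)) (symG : SymmetricFn (edge G)) where

  N = suc n
  e = edge G

  critical : ℕ → ℕ → Bool
  critical v j = (suc j <ᵇ N) ∧ (not (twin G j (suc j)) ∧ twinB N (eraseCol v e) j (suc j))

  criticalCount : ℕ → ℕ
  criticalCount v = count (critical v) N

  critical-unique : ∀ v v' j → T (critical v j) → T (critical v' j) → v ≡ v'
  critical-unique v v' j crit crit' with v ≟ v'
  ... | yes v≡v' = v≡v'
  ... | no v≢v' = ⊥-elim (not-elim _ (∧-fst (not (twin G j (suc j))) rest) (twinB-complete N e j (suc j) twins))
    where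
    rest = ∧-snd (suc j <ᵇ N) crit
    apart : ∀ v → T (critical v j) → TwinsApartFrom N e v j (suc j)
    apart v crit = Twins-eraseCol⁻ N e v j (suc j)
      (twinB-sound N (eraseCol v e) j (suc j) (∧-snd (not (twin G j (suc j))) (∧-snd (suc j <ᵇ N) crit)))
    twins = Twins-glue N e v v' j (suc j) v≢v' (apart v crit) (apart v' crit')

  criticalCount-total : sumTo criticalCount N ≤ N
  criticalCount-total = begin
    sumTo criticalCount N                          ≡⟨ sumTo-swap (λ v j → bit (critical v j)) N N ⟩
    sumTo (λ j → count (λ v → critical v j) N) N   ≤⟨ sumTo-mono N (λ j _ → atMostOne j) ⟩
    sumTo (λ _ → 1) N                              ≡⟨ count-all (λ _ → true) N (λ _ _ → _) ⟩
    N                                              ∎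
    where
    open ≤-Reasoning
    atMostOne : ∀ j → count (λ v → critical v j) N ≤ 1
    atMostOne j = count-atMostOne (λ v → critical v j) N (λ v v' _ _ → critical-unique v v' j)

  delete-symmetric : (v : Fin N) → SymmetricFn (edge (delete G v))
  delete-symmetric v i j = trans (edge-delete G v i j) (trans (symG _ _) (sym (edge-delete G v j i)))

  module _ (vertex : Fin N) where
    H = delete G vertex
    v = toℕ vertex
    σ = skip v
    module BG = Blocks G symG
    module BH = Blocks H (delete-symmetric vertex)

    v≤n : v ≤ n
    v≤n = ≤-pred (toℕ<n vertex)

    link-after-delete : ∀ i → suc i < n → suc i ≢ v → BH.Link i → BG.Link (σ i) ⊎ T (critical v (σ i))
    link-after-delete i i+1<n i+1≢v link with T? (twin G (σ i) (suc (σ i)))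
    ... | yes linkG = inj₁ linkG
    ... | no notLinkG = inj₂ (∧-intro (<⇒<ᵇ σi+1<N) (∧-intro (not-intro _ notLinkG)
                          (twinB-complete N (eraseCol v e) (σ i) (suc (σ i)) (Twins-eraseCol⁺ N e v _ _ apart))))
      where
      σ[i+1] : σ (suc i) ≡ suc (σ i)
      σ[i+1] = skip-suc v i i+1≢v
      σi+1<N : suc (σ i) < N
      σi+1<N = subst (_< N) σ[i+1] (skip-bound v (suc i) n i+1<n)
      twinsH = twinB-sound n (edge H) i (suc i) link
      apart : TwinsApartFrom N e v (σ i) (suc (σ i))
      apart z' z'<N z'≢σi z'≢σi+1 z'≢v with skip-onto v z' z'≢v
      ... | z , refl = begin
        e (σ i) (σ z)          ≡⟨ sym (edge-delete G vertex i z) ⟩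
        edge H i z             ≡⟨ twinsH z (skip-bound⁻ v z n v≤n z'<N) (z'≢σi ∘ cong σ) (λ z≡i+1 → z'≢σi+1 (trans (cong σ z≡i+1) σ[i+1])) ⟩
        edge H (suc i) z       ≡⟨ edge-delete G vertex (suc i) z ⟩
        e (σ (suc i)) (σ z)    ≡⟨ cong (λ y → e y (σ z)) σ[i+1] ⟩
        e (suc (σ i)) (σ z)    ∎
        where open ≡-Reasoning

    explains : ℕ → Bool
    explains k = BG.middle (σ k) ∨ critical v (σ k) ∨ critical v (suc (σ k)) ∨ (suc k ≡ᵇ v) ∨ (suc (suc k) ≡ᵇ v)

    middle-after-delete : ∀ k → T (BH.middle k) → T (explains k)
    middle-after-delete k mid with suc k ≟ v | suc (suc k) ≟ v
    ... | yes k+1≡v | _ =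
      ∨-introʳ (BG.middle (σ k)) (∨-introʳ (critical v (σ k)) (∨-introʳ (critical v (suc (σ k)))
        (∨-introˡ _ (≡⇒≡ᵇ _ _ k+1≡v))))
    ... | no _ | yes k+2≡v =
      ∨-introʳ (BG.middle (σ k)) (∨-introʳ (critical v (σ k)) (∨-introʳ (critical v (suc (σ k)))
        (∨-introʳ (suc k ≡ᵇ v) (≡⇒≡ᵇ _ _ k+2≡v))))
    ... | no k+1≢v | no k+2≢v
      with link-after-delete k (<-trans (n<1+n (suc k)) k+2<n) k+1≢v (∧-fst (twin H k (suc k)) links)
         | link-after-delete (suc k) k+2<n k+2≢v (∧-snd (twin H k (suc k)) links)
      where
      k+2<n = <ᵇ⇒< (suc (suc k)) n (∧-fst (suc (suc k) <ᵇ n) mid)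
      links = ∧-snd (suc (suc k) <ᵇ n) mid
    ...   | inj₂ crit₀ | _ = ∨-introʳ (BG.middle (σ k)) (∨-introˡ _ crit₀)
    ...   | inj₁ _ | inj₂ crit₁ =
      ∨-introʳ (BG.middle (σ k)) (∨-introʳ (critical v (σ k))
        (∨-introˡ _ (subst (T ∘ critical v) (skip-suc v k k+1≢v) crit₁)))
    ...   | inj₁ link₀ | inj₁ link₁ =
      ∨-introˡ _ (∧-intro (<⇒<ᵇ σk+2<N) (∧-intro link₀ (subst BG.Link σ[k+1] link₁)))
      where
      σ[k+1] : σ (suc k) ≡ suc (σ k)
      σ[k+1] = skip-suc v k k+1≢v
      σk+2<N : suc (suc (σ k)) < N
      σk+2<N = subst (_< N) (trans (skip-suc v (suc k) k+2≢v) (cong suc σ[k+1]))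
                     (skip-bound v (suc (suc k)) n (<ᵇ⇒< (suc (suc k)) n (∧-fst (suc (suc k) <ᵇ n) mid)))

    middles-after-delete : count BH.middle n ≤ count BG.middle N + 2 * criticalCount v + 2
    middles-after-delete = begin
      count BH.middle n                                   ≤⟨ sumTo-mono n (λ k _ → bit-mono _ _ (middle-after-delete k)) ⟩
      count explains n                                    ≤⟨ sumTo-mono n (λ k _ → bits k) ⟩
      sumTo (λ k → f₁ k + (f₂ k + (f₃ k + (f₄ k + f₅ k)))) n  ≡⟨ split ⟩
      S f₁ + (S f₂ + (S f₃ + (S f₄ + S f₅)))              ≤⟨ +-mono-≤ bound₁ (+-mono-≤ bound₂ (+-mono-≤ bound₃ (+-mono-≤ bound₄ bound₅))) ⟩
      count BG.middle N + (criticalCount v + (criticalCount v + (1 + 1)))  ≡⟨ arith (count BG.middle N) (criticalCount v) ⟩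
      count BG.middle N + 2 * criticalCount v + 2         ∎
      where
      open ≤-Reasoning
      S = λ f → sumTo f n
      f₁ f₂ f₃ f₄ f₅ : ℕ → ℕ
      f₁ k = bit (BG.middle (σ k))
      f₂ k = bit (critical v (σ k))
      f₃ k = bit (critical v (suc (σ k)))
      f₄ k = bit (suc k ≡ᵇ v)
      f₅ k = bit (suc (suc k) ≡ᵇ v)
      bits : ∀ k → bit (explains k) ≤ f₁ k + (f₂ k + (f₃ k + (f₄ k + f₅ k)))
      bits k = ≤-trans (bit-∨ (BG.middle (σ k)) _) (+-monoʳ-≤ (f₁ k)
               (≤-trans (bit-∨ (critical v (σ k)) _) (+-monoʳ-≤ (f₂ k)
               (≤-trans (bit-∨ (critical v (suc (σ k))) _) (+-monoʳ-≤ (f₃ k)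
               (bit-∨ (suc k ≡ᵇ v) _))))))
      split : S (λ k → f₁ k + (f₂ k + (f₃ k + (f₄ k + f₅ k)))) ≡ S f₁ + (S f₂ + (S f₃ + (S f₄ + S f₅)))
      split = trans (sumTo-+ f₁ _ n) (cong (S f₁ +_) (trans (sumTo-+ f₂ _ n) (cong (S f₂ +_)
              (trans (sumTo-+ f₃ _ n) (cong (S f₃ +_) (sumTo-+ f₄ f₅ n))))))
      σ<N : ∀ k → k < n → σ k < N
      σ<N k k<n = skip-bound v k n k<n
      bound₁ : S f₁ ≤ count BG.middle N
      bound₁ = sumTo-reindex (bit ∘ BG.middle) σ (skip-increasing v) n N σ<N
      bound₂ : S f₂ ≤ criticalCount v
      bound₂ = sumTo-reindex (bit ∘ critical v) σ (skip-increasing v) n N σ<N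
      -- the extra index N is never critical, as N + 1 ≮ N
      bound₃ : S f₃ ≤ criticalCount v
      bound₃ = begin
        S f₃                                     ≤⟨ sumTo-reindex (bit ∘ critical v) (suc ∘ σ) (s≤s ∘ skip-increasing v) n (suc N) (λ k k<n → s≤s (σ<N k k<n)) ⟩
        criticalCount v + bit (critical v N)     ≡⟨ cong (criticalCount v +_) (bit-false λ crit → <-asym (n<1+n N) (<ᵇ⇒< (suc N) N (∧-fst (suc N <ᵇ N) crit))) ⟩
        criticalCount v + 0                      ≡⟨ +-identityʳ _ ⟩
        criticalCount v                          ∎
      bound₄ : S f₄ ≤ 1
      bound₄ = count-atMostOne (λ k → suc k ≡ᵇ v) n
                 (λ k l _ _ tk tl → suc-injective (trans (≡ᵇ⇒≡ (suc k) v tk) (sym (≡ᵇ⇒≡ (suc l) v tl))))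
      bound₅ : S f₅ ≤ 1
      bound₅ = count-atMostOne (λ k → suc (suc k) ≡ᵇ v) n
                 (λ k l _ _ tk tl → suc-injective (suc-injective (trans (≡ᵇ⇒≡ (suc (suc k)) v tk) (sym (≡ᵇ⇒≡ (suc (suc l)) v tl)))))
      arith : ∀ m c → m + (c + (c + (1 + 1))) ≡ m + 2 * c + 2
      arith = solve-∀

-- Three vertices u < w < x with G - u = G - w = G - x force w to be the centre
-- of a middle position: w - 1 ∼ w ∼ w + 1.
module Collisions {n} (G : Adj (suc n)) where

  N = suc n
  e = edge G

  SameDeletion : ℕ → ℕ → Set
  SameDeletion a b = ∀ i j → e (skip a i) (skip a j) ≡ e (skip b i) (skip b j)

  sameDeletion : ∀ (a b : Fin N) → delete G a ≡ delete G b → SameDeletion (toℕ a) (toℕ b)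
  sameDeletion a b G-a≡G-b i j =
    trans (sym (edge-delete G a i j)) (trans (cong (λ H → edge H i j) G-a≡G-b) (edge-delete G b i j))

  readOff : ∀ {a b} → SameDeletion a b → ∀ i j {p q r s} →
            skip a i ≡ p → skip a j ≡ q → skip b i ≡ r → skip b j ≡ s → e p q ≡ e r s
  readOff same i j refl refl refl refl = same i j

  pred-below : ∀ {w z} → w < z → suc (pred z) ≡ z
  pred-below {z = suc z} _ = refl

  twins-left : ∀ u w' x → u ≤ w' → suc w' < x →
               SameDeletion u (suc w') → SameDeletion (suc w') x → SameDeletion u x → Twins N e w' (suc w')
  twins-left u w' x u≤w' w<x Duw Dwx Dux z _ z≢w' z≢w with <-cmp z (suc w')
  ... | tri≈ _ z≡w _ = ⊥-elim (z≢w z≡w)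
  ... | tri> _ _ w<z =
    sym (readOff Duw w' (pred z) (skip-above u w' u≤w') (trans (skip-above u (pred z) (≤-trans u≤w' w'≤z-1)) z+1-1)
                                 (skip-below (suc w') w' ≤-refl) (trans (skip-above (suc w') (pred z) w≤z-1) z+1-1))
    where
    z+1-1 = pred-below w<z
    w≤z-1 : suc w' ≤ pred z
    w≤z-1 = ≤-pred (≤-trans w<z (≤-reflexive (sym z+1-1)))
    w'≤z-1 = ≤-trans (n≤1+n w') w≤z-1
  ... | tri< z<w _ _ with z <? u
  ...   | yes z<u =
    sym (readOff Duw w' z (skip-above u w' u≤w') (skip-below u z z<u) (skip-below (suc w') w' ≤-refl) (skip-below (suc w') z z<w))
  ...   | no z≮u = begin
    e w' z                ≡⟨ sym (readOff Duw w' z (skip-above u w' u≤w') (skip-above u z u≤z) (skip-below (suc w') w' ≤-refl) (skip-below (suc w') z z<w)) ⟩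
    e (suc w') (suc z)    ≡⟨ sym (readOff Dwx (suc w') (suc z) (skip-above (suc w') (suc w') ≤-refl) (skip-below (suc w') (suc z) (s≤s z<w'))
                                                        (skip-below x (suc w') w<x) (skip-below x (suc z) (<-trans (s≤s z<w') w<x))) ⟩
    e (suc (suc w')) (suc z) ≡⟨ readOff Dux (suc w') z (skip-above u (suc w') (m≤n⇒m≤1+n u≤w')) (skip-above u z u≤z)
                                                    (skip-below x (suc w') w<x) (skip-below x z (<-trans z<w w<x)) ⟩
    e (suc w') z          ∎
    where
    open ≡-Reasoning
    u≤z = ≮⇒≥ z≮u
    z<w' : z < w'
    z<w' = ≤∧≢⇒< (≤-pred z<w) z≢w'

  -- w ∼ w + 1, using w - 1 ∼ w for the vertices between w + 1 and x.
  twins-right : ∀ u w' x → u ≤ w' → suc w' < x →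
                SameDeletion u (suc w') → SameDeletion (suc w') x → SameDeletion u x → Twins N e (suc w') (suc (suc w'))
  twins-right u w' x u≤w' w<x Duw Dwx Dux z z<N z≢w z≢w+1 with <-cmp z (suc w')
  ... | tri≈ _ z≡w _ = ⊥-elim (z≢w z≡w)
  ... | tri< z<w _ _ =
    sym (readOff Dwx (suc w') z (skip-above (suc w') (suc w') ≤-refl) (skip-below (suc w') z z<w)
                                (skip-below x (suc w') w<x) (skip-below x z (<-trans z<w w<x)))
  ... | tri> _ _ w<z with x ≤? pred z
  ...   | yes x≤z-1 =
    sym (readOff Dwx w (pred z) (skip-above w w ≤-refl) (trans (skip-above w (pred z) (≤-trans (<⇒≤ w<x) x≤z-1)) z+1-1)
                                (skip-below x w w<x) (trans (skip-above x (pred z) x≤z-1) z+1-1))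
    where
    w = suc w'
    z+1-1 = pred-below w<z
  ...   | no x≰z-1 = begin
    e w z               ≡⟨ readOff Dux w' (pred z) (skip-above u w' u≤w') (trans (skip-above u (pred z) (≤-trans (m≤n⇒m≤1+n u≤w') w≤z-1)) z+1-1)
                                                   (skip-below x w' (<-trans (n<1+n w') w<x)) (skip-below x (pred z) (≰⇒> x≰z-1)) ⟩
    e w' (pred z)       ≡⟨ twins-left u w' x u≤w' w<x Duw Dwx Dux (pred z) (≤-<-trans pred[n]≤n z<N)
                                            (λ eq → <⇒≢ w≤z-1 (sym eq)) (λ eq → z≢w+1 (trans (sym z+1-1) (cong suc eq))) ⟩
    e w (pred z)        ≡⟨ sym (readOff Dwx w (pred z) (skip-above w w ≤-refl) (trans (skip-above w (pred z) w≤z-1) z+1-1)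
                                                       (skip-below x w w<x) (skip-below x (pred z) (≰⇒> x≰z-1))) ⟩
    e (suc w) z         ∎
    where
    open ≡-Reasoning
    w = suc w'
    z+1-1 = pred-below w<z
    w≤z-1 : w ≤ pred z
    w≤z-1 = ≤-pred (≤-trans w<z (≤-reflexive (sym z+1-1)))

  centre : ℕ → Bool
  centre zero = false
  centre (suc w') = middleOf G w'

  collision : ∀ (u w x : Fin N) → toℕ u < toℕ w → toℕ w < toℕ x →
              delete G u ≡ delete G w → delete G w ≡ delete G x → T (centre (toℕ w))
  collision u w x u<w w<x G-u≡G-w G-w≡G-x with toℕ w in w≡
  ... | zero = ⊥-elim (n≮0 u<w)
  ... | suc w' =
    ∧-intro (<⇒<ᵇ (<-≤-trans w<x (≤-pred (toℕ<n x))))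
      (∧-intro (twinB-complete N e w' (suc w') (twins-left (toℕ u) w' (toℕ x) (≤-pred u<w) w<x Duw Dwx Dux))
               (twinB-complete N e (suc w') (suc (suc w')) (twins-right (toℕ u) w' (toℕ x) (≤-pred u<w) w<x Duw Dwx Dux)))
    where
    Duw = subst (SameDeletion (toℕ u)) w≡ (sameDeletion u w G-u≡G-w)
    Dwx = subst (λ a → SameDeletion a (toℕ x)) w≡ (sameDeletion w x G-w≡G-x)
    Dux = sameDeletion u x (trans G-u≡G-w G-w≡G-x)

module Deck {n} (G : Adj (suc n)) (symG : SymmetricFn (edge G)) (r : ℕ) where

  N = suc n
  open Deletion G symG using (criticalCount; criticalCount-total; delete-symmetric; middles-after-delete)
  open Collisions G using (centre; collision)
  open Blocks G symG using (excess≡middles)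

  good : Adj n → Bool
  good H = excess H ≤ᵇ excess G + 2 * r + 1

  bad : ℕ → Bool
  bad v = r ≤ᵇ criticalCount v

  eligible : Fin N → Bool
  eligible v = not (bad (toℕ v)) ∧ not (centre (toℕ v))

  -- Few vertices are bad, since there are at most N critical pairs in all.
  bad-few : r * count bad N ≤ N
  bad-few = begin
    r * count bad N                     ≡⟨ sumTo-scale r (bit ∘ bad) N ⟩
    sumTo (λ v → r * bit (bad v)) N     ≤⟨ sumTo-mono N (λ v _ → atMost v) ⟩
    sumTo criticalCount N               ≤⟨ criticalCount-total ⟩
    N                                   ∎
    where
    open ≤-Reasoning
    atMost : ∀ v → r * bit (bad v) ≤ criticalCount v
    atMost v with T? (bad v)
    ... | yes isBad = ≤-trans (≤-reflexive (trans (cong (r *_) (bit-true isBad)) (*-identityʳ r))) (≤ᵇ⇒≤ r _ isBad)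
    ... | no notBad = ≤-trans (≤-reflexive (trans (cong (r *_) (bit-false notBad)) (*-zeroʳ r))) z≤n

  -- Centres correspond to middle positions, so there are at most m(G) of them.
  centres-few : count centre N ≤ excess G
  centres-few = begin
    count centre N                 ≡⟨ sumTo-shift (bit ∘ centre) n ⟩
    count (middleOf G) n           ≤⟨ sumTo-extend (bit ∘ middleOf G) (n≤1+n n) ⟩
    count (middleOf G) N           ≡⟨ sym excess≡middles ⟩
    excess G                       ∎
    where open ≤-Reasoning

  notBad⇒good : ∀ v → ¬ T (bad (toℕ v)) → T (good (delete G v))
  notBad⇒good v notBad = ≤⇒≤ᵇ (begin
    excess (delete G v)                                    ≡⟨ Blocks.excess≡middles (delete G v) (delete-symmetric v) ⟩
    count (middleOf (delete G v)) n                        ≤⟨ middles-after-delete v ⟩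
    count (middleOf G) N + 2 * c + 2                       ≡⟨ cong (λ m → m + 2 * c + 2) (sym excess≡middles) ⟩
    excess G + 2 * c + 2                                   ≡⟨ regroup (excess G) c ⟩
    excess G + 2 * suc c                                   ≤⟨ +-monoʳ-≤ (excess G) (*-monoʳ-≤ 2 c<r) ⟩
    excess G + 2 * r                                       ≤⟨ m≤m+n _ 1 ⟩
    excess G + 2 * r + 1                                   ∎)
    where
    open ≤-Reasoning
    c = criticalCount (toℕ v)
    c<r : c < r
    c<r = ≰⇒> (notBad ∘ ≤⇒≤ᵇ)
    regroup : ∀ m c → m + 2 * c + 2 ≡ m + 2 * suc c
    regroup = solve-∀

  eligibleDeletions : List (Adj n)
  eligibleDeletions = select eligible (delete G)

  goodDeck : List (Adj n)
  goodDeck = filterᵇ good (boundary G)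

  eligible⊆goodDeck : ∀ {H} → H ∈ eligibleDeletions → H ∈ goodDeck
  eligible⊆goodDeck H∈ with ∈-select eligible (delete G) H∈
  ... | v , isEligible , refl =
    ∈-filter⁺ (T? ∘ good) (∈-deduplicate⁺ adjDec (∈-map⁺ (delete G) (∈-allFin v)))
              (notBad⇒good v (not-elim _ (∧-fst (not (bad (toℕ v))) isEligible)))

  open Multiplicity (adjDec {n})

  -- No graph arises from three eligible vertices, since the middle one would be a centre.
  eligible-atMostTwice : ∀ (H : Adj n) → occurrences H eligibleDeletions ≤ 2
  eligible-atMostTwice H =
    ≤-trans (≤-reflexive (occurrences-select eligible (delete G) H)) (sumFin-atMostTwo {N} yieldsH noTriple)
    where
    yieldsH : Fin N → Bool
    yieldsH v = eligible v ∧ does (adjDec (delete G v) H)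
    isH : ∀ v → T (eligible v ∧ does (adjDec (delete G v) H)) → delete G v ≡ H
    isH v t = does-true (adjDec (delete G v) H) (∧-snd (eligible v) t)
    notCentre : ∀ v → T (yieldsH v) → ¬ T (centre (toℕ v))
    notCentre v t = not-elim _ (∧-snd (not (bad (toℕ v))) (∧-fst (eligible v) t))
    noTriple : ∀ u w x → toℕ u < toℕ w → toℕ w < toℕ x → T (yieldsH u) → T (yieldsH w) → T (yieldsH x) → ⊥
    noTriple u w x u<w w<x tu tw tx =
      notCentre w tw (collision u w x u<w w<x (trans (isH u tu) (sym (isH w tw))) (trans (isH w tw) (sym (isH x tx))))

  eligible-few : sumFin (bit ∘ eligible) ≤ 2 * goodCount r G
  eligible-few = begin
    sumFin (bit ∘ eligible)       ≡⟨ sym (length-select eligible (delete G)) ⟩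
    length eligibleDeletions      ≤⟨ length-≤-multiplicity 2 goodDeck goodDeck-unique eligibleDeletions eligible⊆goodDeck eligible-atMostTwice ⟩
    2 * goodCount r G             ∎
    where
    open ≤-Reasoning
    goodDeck-unique = Unique.filter⁺ (T? ∘ good) (Unique.deduplicate-! adjDec (map (delete G) (allFin N)))

  cover : N ≤ sumFin (bit ∘ eligible) + count bad N + count centre N
  cover = begin
    N                                                ≡⟨ sym (sumFin-ones N) ⟩
    sumFin {N} (λ _ → 1)                             ≤⟨ sumFin-mono (λ _ → 1) (λ v → E v + B v + C v) (λ v → oneOf (bad (toℕ v)) (centre (toℕ v))) ⟩
    sumFin (λ v → E v + B v + C v)                   ≡⟨ sumFin-+ (λ v → E v + B v) C ⟩
    sumFin (λ v → E v + B v) + sumFin C              ≡⟨ cong (_+ sumFin C) (sumFin-+ E B) ⟩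
    sumFin E + sumFin B + sumFin C                   ≡⟨ cong₂ (λ x y → sumFin E + x + y) (sumFin-toℕ N (bit ∘ bad)) (sumFin-toℕ N (bit ∘ centre)) ⟩
    sumFin E + count bad N + count centre N          ∎
    where
    open ≤-Reasoning
    E B C : Fin N → ℕ
    E v = bit (eligible v)
    B v = bit (bad (toℕ v))
    C v = bit (centre (toℕ v))
    oneOf : ∀ b c → 1 ≤ bit (not b ∧ not c) + bit b + bit c
    oneOf true _ = s≤s z≤n
    oneOf false true = s≤s z≤n
    oneOf false false = s≤s z≤n

  theorem : (r ∸ 1) * N ≤ 2 * r * goodCount r G + r * excess G
  theorem = counting-bound r cover eligible-few centres-few bad-few

-- The empty graph is trivial; otherwise apply Deck.
lemma5p2 : (n : ℕ) (G : Adj n) → Symmetric G → Irreflexive G →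
           (r : ℕ) → 1 ≤ r →
           (r ∸ 1) * n ≤ 2 * r * goodCount r G + r * excess G
lemma5p2 zero G _ _ r _ = ≤-trans (≤-reflexive (*-zeroʳ (r ∸ 1))) z≤n
lemma5p2 (suc n) G symG _ r _ = Deck.theorem G (edge-symmetric G symG) r
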